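{- Let $n\ge1$. For $S\subseteq\{(i,j):1\le i<j\le n\}$ define $d_i=|\{h:(h,i)\in S\}|$, $e_i=|\{j:(i,j)\in S\}|$, $\ell_i=(n-i)+d_i-e_i$ for $1\le i\le n$, and let $K(S)$ be the largest nonnegative integer $k$ such that $|\{i:\ell_i=j\}|=1$ for every integer $0\le j<k$. If $K(S)=n$, then there exists a permutation $w\in\mathfrak{S}_n$ such that $S=R(w)$. Conversely, for any $w\in\mathfrak{S}_n$, the set $S=R(w)$ satisfies $K(S)=n$, and $\ell_{w(j)}=n-j$ for every $1\le j\le n$.
   Context: For $w\in\mathfrak{S}_n$, $R(w)=\{(w(j),w(i)):\ 1\le i<j\le n,\ w(j)<w(i)\}$ (the inversion set of $w^{ -1}$). -}

module Defs where

open import Data.Nat using (ℕ; zero; suc; _∸_; _≤_)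
open import Data.Nat as ℕ using ()
open import Data.Bool using (Bool; true; false; if_then_else_)
open import Data.Fin using (Fin; toℕ; _<_)
open import Data.Fin as F using ()
open import Data.Integer as ℤ using (ℤ; +_)
open import Data.Product using (Σ; _×_; ∃; ∃-syntax)
open import Relation.Nullary.Decidable using (⌊_⌋)
open import Relation.Binary.PropositionalEquality using (_≡_)
open import Function.Bundles using (_⇔_)
open import Data.Fin.Permutation using (Permutation′; _⟨$⟩ʳ_)

-- Indices are 0-based: Fin n stands for {1,…,n} via i ↦ toℕ i + 1.
-- A subset S of pairs is a Bool-valued relation on Fin n.
Rel₂ : ℕ → Set
Rel₂ n = Fin n → Fin n → Bool

Upper : ∀ {n} → Rel₂ n → Set
Upper {n} S = ∀ (i j : Fin n) → S i j ≡ true → i < j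

count : ∀ {n} → (Fin n → Bool) → ℕ
count {zero}  p = 0
count {suc n} p = (if p F.zero then 1 else 0) ℕ.+ count (λ i → p (F.suc i))

d : ∀ {n} → Rel₂ n → Fin n → ℕ
d S i = count (λ h → S h i)

e : ∀ {n} → Rel₂ n → Fin n → ℕ
e S i = count (λ j → S i j)

ℓ : ∀ {n} → Rel₂ n → Fin n → ℤ
ℓ {n} S i = (+ (n ∸ suc (toℕ i)) ℤ.+ + d S i) ℤ.- + e S i

GoodUpTo : ∀ {n} → Rel₂ n → ℕ → Set
GoodUpTo {n} S k = ∀ (j : ℕ) → j ℕ.< k → count (λ i → ⌊ ℓ S i ℤ.≟ + j ⌋) ≡ 1

IsK : ∀ {n} → Rel₂ n → ℕ → Set
IsK S k = GoodUpTo S k × (∀ k′ → GoodUpTo S k′ → k′ ≤ k)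

R : ∀ {n} → Permutation′ n → Fin n → Fin n → Set
R w a b = ∃[ i ] ∃[ j ] (i < j × (w ⟨$⟩ʳ j) < (w ⟨$⟩ʳ i)
                         × a ≡ w ⟨$⟩ʳ j × b ≡ w ⟨$⟩ʳ i)

_≐R_ : ∀ {n} → Rel₂ n → Permutation′ n → Set
S ≐R w = ∀ a b → (S a b ≡ true) ⇔ R w a b

-- Read S as a tournament on {1,…,n}: for i < j, j beats i if (i,j) ∈ S and i beats j otherwise.
-- Then ℓ_i is the score of i (the number of vertices it beats), so K(S) = n says that the scores
-- are 0, …, n-1, each once. Such a tournament is transitive: by downward induction on the score,
-- every vertex of higher score beats v, so all of v's victims have lower score, and since there are
-- exactly score(v) vertices of lower score, v beats all of them. Listing the vertices by decreasing
-- score gives w, and S = R(w) says exactly that the tournament of S is the transitive tournament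
-- ordered by w; in that tournament w(j) beats the n - j vertices after it.

module Submission where

open import Defs
open import Data.Nat using (ℕ; suc; _∸_; _≤_)
open import Data.Fin using (Fin; toℕ)
open import Data.Integer using (+_)
open import Data.Product using (_×_; ∃-syntax)
open import Relation.Binary.PropositionalEquality using (_≡_)
open import Data.Fin.Permutation using (Permutation′; _⟨$⟩ʳ_)

open import Data.Bool using (Bool; true; false; not; _∧_; _∨_; if_then_else_)
import Data.Bool.Properties as Boolₚ
open import Data.Fin as F using (zero; suc)
import Data.Fin.Properties as Fₚ
open import Data.Fin.Permutation using (_⟨$⟩ˡ_; permutation; inverseʳ)
import Data.Integer as ℤ
import Data.Integer.Properties as ℤₚ
open import Data.Integer.Solver using (module +-*-Solver)
open +-*-Solver using (solve; _:+_; _:-_; _:=_)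
open import Data.Nat using (zero; z≤n; s≤s; _<_; _+_; _≟_; _<?_)
open import Data.Nat.Induction using (<-wellFounded)
import Data.Nat.Properties as ℕₚ
open import Data.Product using (_,_; proj₁; proj₂; map₂)
open import Function using (_∘_)
open import Function.Bundles using (_⇔_; mk⇔; Equivalence; Injection)
open import Function.Properties.Inverse using (↔⇒↣)
open import Induction.WellFounded using (module All)
import Relation.Binary.Construct.On as On
open import Relation.Binary.Definitions using (tri<; tri≈; tri>)
open import Relation.Binary.PropositionalEquality
  using (refl; sym; trans; cong; cong₂; subst; subst₂; _≢_; module ≡-Reasoning)
open import Relation.Nullary using (Dec; yes; no; does; ¬_; contradiction)
open import Relation.Nullary.Decidable using (⌊_⌋; dec-true; dec-false; does-⇔; isYes≗does)

open import Algebra.Properties.CommutativeMonoid.Sum ℕₚ.+-0-commutativeMonoid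
  using (sum; sum-permute)

private variable
  n : ℕ

≡-does : ∀ {a} {A : Set a} {b : Bool} → (b ≡ true → A) → (A → b ≡ true) → (a? : Dec A) → b ≡ does a?
≡-does {b = true}  to _    (no ¬a) = contradiction (to refl) ¬a
≡-does {b = true}  _  _    (yes _) = refl
≡-does {b = false} _  from (yes a) = from a
≡-does {b = false} _  _    (no _)  = refl

witness : ∀ {a} {A : Set a} (a? : Dec A) → does a? ≡ true → A
witness (yes a) _ = a

count-cong : {p q : Fin n → Bool} → (∀ i → p i ≡ q i) → count p ≡ count q
count-cong {zero}  _   = refl
count-cong {suc n} p≗q = cong₂ _+_ (cong (λ b → if b then 1 else 0) (p≗q zero)) (count-cong (p≗q ∘ suc))

count-false : {p : Fin n → Bool} → (∀ i → p i ≡ false) → count p ≡ 0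
count-false {zero}  _    = refl
count-false {suc n} none rewrite none zero = count-false (none ∘ suc)

count-true : {p : Fin n → Bool} → (∀ i → p i ≡ true) → count p ≡ n
count-true {zero}  _   = refl
count-true {suc n} all rewrite all zero = cong suc (count-true (all ∘ suc))

count-pos : {p : Fin n → Bool} (a : Fin n) → p a ≡ true → 1 ≤ count p
count-pos {suc n}     zero    pa rewrite pa = s≤s z≤n
count-pos {suc n} {p} (suc a) pa =
  ℕₚ.≤-trans (count-pos {p = p ∘ suc} a pa) (ℕₚ.m≤n+m _ (if p zero then 1 else 0))

count-witness : {p : Fin n → Bool} → 1 ≤ count p → ∃[ a ] p a ≡ true
count-witness {suc n} {p} pos with p zero in p₀
... | true  = zero , p₀
... | false with a , pa ← count-witness {p = p ∘ suc} pos = suc a , pa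

count-split : {p q r : Fin n → Bool} → (∀ i → p i ≡ q i ∨ r i) → (∀ i → q i ≡ true → r i ≡ false) →
              count p ≡ count q + count r
count-split {zero} _ _ = refl
count-split {suc n} {p} {q} {r} p≗q∨r disjoint rewrite p≗q∨r zero with q zero in q₀ | r zero in r₀
... | true  | true  = contradiction (trans (sym r₀) (disjoint zero q₀)) λ ()
... | true  | false = cong suc (count-split (p≗q∨r ∘ suc) (disjoint ∘ suc))
... | false | true  = trans (cong suc (count-split (p≗q∨r ∘ suc) (disjoint ∘ suc))) (sym (ℕₚ.+-suc _ _))
... | false | false = count-split (p≗q∨r ∘ suc) (disjoint ∘ suc)

count-complement : (p : Fin n → Bool) → count p + count (not ∘ p) ≡ n
count-complement p =
  trans (sym (count-split (λ i → sym (Boolₚ.∨-inverseʳ (p i))) (λ i → cong not))) (count-true λ _ → refl)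

count<n : {p : Fin n → Bool} (a : Fin n) → p a ≡ false → count p < n
count<n {n} {p} a pa = begin-strict
  count p                     <⟨ ℕₚ.m<m+n (count p) (count-pos {p = not ∘ p} a (cong not pa)) ⟩
  count p + count (not ∘ p)   ≡⟨ count-complement p ⟩
  n                           ∎
  where open ℕₚ.≤-Reasoning

count-⊆⇒⊇ : {p q : Fin n → Bool} → (∀ i → p i ≡ true → q i ≡ true) → count p ≡ count q →
            ∀ i → q i ≡ true → p i ≡ true
count-⊆⇒⊇ {p = p} {q} p⊆q same i qi with p i in pi
... | true  = refl
... | false = contradiction (count-pos {p = q∖p} i (cong₂ _∧_ qi (cong not pi))) λ 1≤ → ℕₚ.<-irrefl (sym none) 1≤
  where
  q∖p : _ → Bool
  q∖p j = q j ∧ not (p j)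
  q≗p∨q∖p : ∀ j → q j ≡ p j ∨ q∖p j
  q≗p∨q∖p j with p j in pj
  ... | true  = p⊆q j pj
  ... | false = sym (Boolₚ.∧-identityʳ (q j))
  disjoint : ∀ j → p j ≡ true → q∖p j ≡ false
  disjoint j pj = trans (cong (λ b → q j ∧ not b) pj) (Boolₚ.∧-zeroʳ (q j))
  none : count q∖p ≡ 0
  none = ℕₚ.+-cancelˡ-≡ (count p) _ 0 (begin
    count p + count q∖p  ≡⟨ count-split q≗p∨q∖p disjoint ⟨
    count q              ≡⟨ same ⟨
    count p              ≡⟨ ℕₚ.+-identityʳ (count p) ⟨
    count p + 0          ∎)
    where open ≡-Reasoning

count-unique : {p : Fin n → Bool} → count p ≡ 1 → ∀ {a b} → p a ≡ true → p b ≡ true → a ≡ b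
count-unique {suc n} {p} one {a} {b} pa pb with p zero in p₀
count-unique one {zero}  {zero}  pa pb | _     = refl
count-unique one {zero}  {suc b} pa pb | true  = contradiction (count-pos b pb) (ℕₚ.<-irrefl (ℕₚ.suc-injective (sym one)))
count-unique one {suc a} {_}     pa pb | true  = contradiction (count-pos a pa) (ℕₚ.<-irrefl (ℕₚ.suc-injective (sym one)))
count-unique one {zero}  {_}     pa pb | false = contradiction (trans (sym p₀) pa) λ ()
count-unique one {suc a} {zero}  pa pb | false = contradiction (trans (sym p₀) pb) λ ()
count-unique one {suc a} {suc b} pa pb | false = cong suc (count-unique one pa pb)

count-sum : (p : Fin n → Bool) → count p ≡ sum (λ i → if p i then 1 else 0)
count-sum {zero}  p = refl
count-sum {suc n} p = cong₂ _+_ refl (count-sum (p ∘ suc))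

count-permute : (w : Permutation′ n) (p : Fin n → Bool) → count p ≡ count (p ∘ (w ⟨$⟩ʳ_))
count-permute w p = begin
  count p                                   ≡⟨ count-sum p ⟩
  sum (λ i → if p i then 1 else 0)          ≡⟨ sum-permute _ w ⟩
  sum (λ i → if p (w ⟨$⟩ʳ i) then 1 else 0) ≡⟨ count-sum (p ∘ (w ⟨$⟩ʳ_)) ⟨
  count (p ∘ (w ⟨$⟩ʳ_))                     ∎
  where open ≡-Reasoning

count-above : (j : Fin n) → count (λ (i : Fin n) → does (j Fₚ.<? i)) ≡ n ∸ suc (toℕ j)
count-above {suc n} zero    = count-true {n} (λ i → dec-true (zero {n} Fₚ.<? suc i) (s≤s z≤n))
count-above {suc n} (suc j) = count-above {n} j

count-reversed : ∀ {j} → j < n → count (λ (i : Fin n) → does (n ∸ suc (toℕ i) ≟ j)) ≡ 1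
count-reversed {suc n} {j} j<1+n with n ≟ j
... | yes refl = cong₂ _+_ (cong (λ b → if b then 1 else 0) (dec-true (n ≟ n) refl))
                   (count-false λ i → dec-false (n ∸ suc (toℕ i) ≟ n)
                                        (ℕₚ.<⇒≢ (ℕₚ.∸-monoʳ-< (s≤s z≤n) (Fₚ.toℕ<n i))))
... | no n≢j   = cong₂ _+_ (cong (λ b → if b then 1 else 0) (dec-false (n ≟ j) n≢j))
                   (count-reversed (ℕₚ.≤∧≢⇒< (ℕₚ.≤-pred j<1+n) (n≢j ∘ sym)))

<-suc-split : ∀ a m → does (a <? suc m) ≡ does (a <? m) ∨ does (a ≟ m)
<-suc-split a m with ℕₚ.<-cmp a m
... | tri< a<m a≢m _   = trans (dec-true (a <? suc m) (ℕₚ.m<n⇒m<1+n a<m))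
                               (sym (cong₂ _∨_ (dec-true (a <? m) a<m) (dec-false (a ≟ m) a≢m)))
... | tri≈ a≮a refl _  = trans (dec-true (a <? suc a) (ℕₚ.n<1+n a))
                               (sym (cong₂ _∨_ (dec-false (a <? a) a≮a) (dec-true (a ≟ a) refl)))
... | tri> a≮m a≢m m<a = trans (dec-false (a <? suc m) λ a<1+m → ℕₚ.≤⇒≯ (ℕₚ.≤-pred a<1+m) m<a)
                               (sym (cong₂ _∨_ (dec-false (a <? m) a≮m) (dec-false (a ≟ m) a≢m)))

reverse-< : (i j : Fin n) → n ∸ suc (toℕ i) < n ∸ suc (toℕ j) ⇔ j F.< i
reverse-< {n} i j = mk⇔
  (λ lt → ℕₚ.≰⇒> λ i≤j → ℕₚ.≤⇒≯ (ℕₚ.∸-monoʳ-≤ n (s≤s i≤j)) lt)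
  (λ j<i → ℕₚ.∸-monoʳ-< (s≤s j<i) (Fₚ.toℕ<n i))

not-<? : ∀ {i j : Fin n} → i ≢ j → not (does (i Fₚ.<? j)) ≡ does (j Fₚ.<? i)
not-<? {i = i} {j} i≢j with Fₚ.<-cmp i j
... | tri< i<j _ j≮i = trans (cong not (dec-true (i Fₚ.<? j) i<j)) (sym (dec-false (j Fₚ.<? i) j≮i))
... | tri≈ _ i≡j _   = contradiction i≡j i≢j
... | tri> i≮j _ j<i = trans (cong not (dec-false (i Fₚ.<? j) i≮j)) (sym (dec-true (j Fₚ.<? i) j<i))

+[m+k]+j-m≡+[j+k] : ∀ m k j → (+ (m + k) ℤ.+ + j) ℤ.- + m ≡ + (j + k)
+[m+k]+j-m≡+[j+k] m k j = begin
  (+ (m + k) ℤ.+ + j) ℤ.- + m     ≡⟨ cong (λ a → (a ℤ.+ + j) ℤ.- + m) (ℤₚ.pos-+ m k) ⟩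
  ((+ m ℤ.+ + k) ℤ.+ + j) ℤ.- + m ≡⟨ solve 3 (λ m k j → ((m :+ k) :+ j) :- m := j :+ k) refl (+ m) (+ k) (+ j) ⟩
  + j ℤ.+ + k                     ≡⟨ ℤₚ.pos-+ j k ⟨
  + (j + k)                       ∎
  where open ≡-Reasoning

-- Tournaments on Fin n: T v u means that v beats u.

score : (Fin n → Fin n → Bool) → Fin n → ℕ
score T v = count (T v)

record IsTournament (T : Fin n → Fin n → Bool) : Set where
  field
    irrefl : ∀ v → T v v ≡ false
    flip   : ∀ {u v} → u ≢ v → T v u ≡ not (T u v)

  score<n : ∀ v → score T v < n
  score<n v = count<n v (irrefl v)

RankedBy : (Fin n → Fin n → Bool) → Permutation′ n → Set
RankedBy T w = ∀ i j → T (w ⟨$⟩ʳ j) (w ⟨$⟩ʳ i) ≡ does (j Fₚ.<? i)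

EachScoreOnce : (Fin n → Fin n → Bool) → Set
EachScoreOnce {n} T = ∀ j → j < n → count (λ v → does (score T v ≟ j)) ≡ 1

module _ {T : Fin n → Fin n → Bool} {w : Permutation′ n} (ranked : RankedBy T w) where

  ranked-score : ∀ j → score T (w ⟨$⟩ʳ j) ≡ n ∸ suc (toℕ j)
  ranked-score j = begin
    count (T (w ⟨$⟩ʳ j))                          ≡⟨ count-permute w _ ⟩
    count (λ i → T (w ⟨$⟩ʳ j) (w ⟨$⟩ʳ i))         ≡⟨ count-cong (λ i → ranked i j) ⟩
    count (λ (i : Fin n) → does (j Fₚ.<? i))      ≡⟨ count-above j ⟩
    n ∸ suc (toℕ j)                               ∎
    where open ≡-Reasoning

  ranked⇒eachScoreOnce : EachScoreOnce T
  ranked⇒eachScoreOnce m m<n = begin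
    count (λ v → does (score T v ≟ m))
      ≡⟨ count-permute w _ ⟩
    count (λ i → does (score T (w ⟨$⟩ʳ i) ≟ m))
      ≡⟨ count-cong (λ i → cong (λ s → does (s ≟ m)) (ranked-score i)) ⟩
    count (λ (i : Fin n) → does (n ∸ suc (toℕ i) ≟ m))
      ≡⟨ count-reversed m<n ⟩
    1 ∎
    where open ≡-Reasoning

module Transitive {T : Fin n → Fin n → Bool} (tournament : IsTournament T) (once : EachScoreOnce T) where
  open IsTournament tournament

  score-injective : ∀ {u v} → score T u ≡ score T v → u ≡ v
  score-injective {u} {v} eq =
    count-unique (once (score T u) (score<n u)) (dec-true (score T u ≟ score T u) refl) (dec-true (score T v ≟ score T u) (sym eq))

  count-score< : ∀ m → m ≤ n → count (λ u → does (score T u <? m)) ≡ m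
  count-score< zero    _   = count-false λ u → dec-false (score T u <? 0) ℕₚ.n≮0
  count-score< (suc m) m<n = begin
    count (λ u → does (score T u <? suc m))
      ≡⟨ count-split (λ u → <-suc-split (score T u) m) disjoint ⟩
    count (λ u → does (score T u <? m)) + count (λ u → does (score T u ≟ m))
      ≡⟨ cong₂ _+_ (count-score< m (ℕₚ.<⇒≤ m<n)) (once m m<n) ⟩
    m + 1
      ≡⟨ ℕₚ.+-comm m 1 ⟩
    suc m ∎
    where
    open ≡-Reasoning
    disjoint : ∀ u → does (score T u <? m) ≡ true → does (score T u ≟ m) ≡ false
    disjoint u lt = dec-false (score T u ≟ m) (ℕₚ.<⇒≢ (witness (score T u <? m) lt))

  beats⇒score< : ∀ {v u} → (∀ w → score T v < score T w → T w v ≡ true) → T v u ≡ true → score T u < score T v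
  beats⇒score< {v} {u} beaten-by-higher vu with ℕₚ.<-cmp (score T u) (score T v)
  ... | tri< u<v _ _ = u<v
  ... | tri≈ _ u≡v _ =
    contradiction (trans (sym vu) (subst (λ x → T v x ≡ false) (sym (score-injective u≡v)) (irrefl v))) λ ()
  ... | tri> _ _ v<u = contradiction (trans (sym vu) (trans (flip u≢v) (cong not (beaten-by-higher u v<u)))) λ ()
    where
    u≢v : u ≢ v
    u≢v u≡v = ℕₚ.<-irrefl (cong (score T) (sym u≡v)) v<u

  Dominant : Fin n → Set
  Dominant v = ∀ u → score T u < score T v → T v u ≡ true

  -- v's victims all have lower score, and there are exactly score v vertices of lower score.
  dominant : ∀ v → (∀ w → score T v < score T w → T w v ≡ true) → Dominant v
  dominant v beaten-by-higher u u<v =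
    count-⊆⇒⊇ (λ u vu → dec-true (score T u <? score T v) (beats⇒score< beaten-by-higher vu))
              (sym (count-score< (score T v) (ℕₚ.<⇒≤ (score<n v))))
              u (dec-true (score T u <? score T v) u<v)

  score<⇒beats : ∀ v → Dominant v
  score<⇒beats = All.wfRec (On.wellFounded (λ v → n ∸ score T v) <-wellFounded) _ Dominant
    λ v higher-dominant → dominant v λ w v<w → higher-dominant (ℕₚ.∸-monoʳ-< v<w (ℕₚ.<⇒≤ (score<n w))) v v<w

  beats≡score< : ∀ v u → T v u ≡ does (score T u <? score T v)
  beats≡score< v u = ≡-does (beats⇒score< (λ w → score<⇒beats w v)) (score<⇒beats v u) (score T u <? score T v)

  rank : Fin n → Fin n
  rank v = F.opposite (F.fromℕ< (score<n v))

  vertex-of-rank : (j : Fin n) → ∃[ v ] score T v ≡ toℕ (F.opposite j)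
  vertex-of-rank j =
    map₂ (witness (_ ≟ _)) (count-witness (ℕₚ.≤-reflexive (sym (once _ (Fₚ.toℕ<n (F.opposite j))))))

  vertex : Fin n → Fin n
  vertex j = proj₁ (vertex-of-rank j)

  score-vertex : ∀ j → score T (vertex j) ≡ n ∸ suc (toℕ j)
  score-vertex j = trans (proj₂ (vertex-of-rank j)) (Fₚ.opposite-prop j)

  rank-vertex : ∀ j → rank (vertex j) ≡ j
  rank-vertex j = trans (cong F.opposite (Fₚ.toℕ-injective (trans (Fₚ.toℕ-fromℕ< _) (proj₂ (vertex-of-rank j)))))
                        (Fₚ.opposite-involutive j)

  vertex-rank : ∀ v → vertex (rank v) ≡ v
  vertex-rank v = score-injective (begin
    score T (vertex (rank v))                           ≡⟨ proj₂ (vertex-of-rank (rank v)) ⟩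
    toℕ (F.opposite (F.opposite (F.fromℕ< (score<n v)))) ≡⟨ cong toℕ (Fₚ.opposite-involutive _) ⟩
    toℕ (F.fromℕ< (score<n v))                          ≡⟨ Fₚ.toℕ-fromℕ< (score<n v) ⟩
    score T v                                           ∎)
    where open ≡-Reasoning

  ranking : Permutation′ n
  ranking = permutation vertex rank vertex-rank rank-vertex

  ranking-ranks : RankedBy T ranking
  ranking-ranks i j = begin
    T (vertex j) (vertex i)
      ≡⟨ beats≡score< (vertex j) (vertex i) ⟩
    does (score T (vertex i) <? score T (vertex j))
      ≡⟨ cong₂ (λ a b → does (a <? b)) (score-vertex i) (score-vertex j) ⟩
    does (n ∸ suc (toℕ i) <? n ∸ suc (toℕ j))
      ≡⟨ does-⇔ (reverse-< i j) (n ∸ suc (toℕ i) <? n ∸ suc (toℕ j)) (j Fₚ.<? i) ⟩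
    does (j Fₚ.<? i) ∎
    where open ≡-Reasoning

beats : Rel₂ n → Fin n → Fin n → Bool
beats S v u = S u v ∨ (does (v Fₚ.<? u) ∧ not (S v u))

module _ {S : Rel₂ n} (upper : Upper S) where

  upper-false : ∀ {u v} → ¬ u F.< v → S u v ≡ false
  upper-false {u} {v} u≮v with S u v in uv
  ... | true  = contradiction (upper u v uv) u≮v
  ... | false = refl

  beats-below : ∀ {u v} → u F.< v → beats S v u ≡ S u v
  beats-below {u} {v} u<v =
    trans (cong (λ b → S u v ∨ (b ∧ not (S v u))) (dec-false (v Fₚ.<? u) (ℕₚ.<-asym u<v)))
          (Boolₚ.∨-identityʳ (S u v))

  beats-above : ∀ {u v} → v F.< u → beats S v u ≡ not (S v u)
  beats-above {u} {v} v<u =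
    cong₂ (λ x y → x ∨ (y ∧ not (S v u))) (upper-false (ℕₚ.<-asym v<u)) (dec-true (v Fₚ.<? u) v<u)

  beats-isTournament : IsTournament (beats S)
  beats-isTournament = record { irrefl = irrefl ; flip = flip }
    where
    irrefl : ∀ v → beats S v v ≡ false
    irrefl v = cong₂ (λ x y → x ∨ (y ∧ not x))
                     (upper-false (ℕₚ.<-irrefl refl)) (dec-false (v Fₚ.<? v) (ℕₚ.<-irrefl refl))
    flip : ∀ {u v} → u ≢ v → beats S v u ≡ not (beats S u v)
    flip {u} {v} u≢v with Fₚ.<-cmp u v
    ... | tri< u<v _ _ = trans (beats-below u<v) (trans (sym (Boolₚ.not-involutive (S u v))) (cong not (sym (beats-above u<v))))
    ... | tri≈ _ u≡v _ = contradiction u≡v u≢v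
    ... | tri> _ _ v<u = trans (beats-above v<u) (cong not (sym (beats-below v<u)))

  ℓ≡score : ∀ v → ℓ S v ≡ + score (beats S) v
  ℓ≡score v = begin
    (+ (n ∸ suc (toℕ v)) ℤ.+ + d S v) ℤ.- + e S v   ≡⟨ cong (λ a → (+ a ℤ.+ + d S v) ℤ.- + e S v) above ⟩
    (+ (e S v + X) ℤ.+ + d S v) ℤ.- + e S v         ≡⟨ +[m+k]+j-m≡+[j+k] (e S v) X (d S v) ⟩
    + (d S v + X)                                   ≡⟨ cong +_ beaten ⟨
    + score (beats S) v                             ∎
    where
    open ≡-Reasoning
    unbeaten-above : Fin n → Bool
    unbeaten-above u = does (v Fₚ.<? u) ∧ not (S v u)
    X = count unbeaten-above
    above : n ∸ suc (toℕ v) ≡ e S v + X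
    above = trans (sym (count-above v)) (count-split split disjoint)
      where
      split : ∀ u → does (v Fₚ.<? u) ≡ S v u ∨ unbeaten-above u
      split u with S v u in vu
      ... | true  = dec-true (v Fₚ.<? u) (upper v u vu)
      ... | false = sym (Boolₚ.∧-identityʳ _)
      disjoint : ∀ u → S v u ≡ true → unbeaten-above u ≡ false
      disjoint u vu = trans (cong (λ b → does (v Fₚ.<? u) ∧ not b) vu) (Boolₚ.∧-zeroʳ _)
    beaten : score (beats S) v ≡ d S v + X
    beaten = count-split (λ _ → refl) (λ u uv → cong (_∧ not (S v u)) (dec-false (v Fₚ.<? u) (ℕₚ.<-asym (upper u v uv))))

  count-ℓ≡count-score : ∀ j → count (λ i → ⌊ ℓ S i ℤ.≟ + j ⌋) ≡ count (λ i → does (score (beats S) i ≟ j))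
  count-ℓ≡count-score j = count-cong λ i → trans (isYes≗does (ℓ S i ℤ.≟ + j))
    (does-⇔ (mk⇔ (λ eq → ℤₚ.+-injective (trans (sym (ℓ≡score i)) eq)) (λ eq → trans (ℓ≡score i) (cong +_ eq)))
            (ℓ S i ℤ.≟ + j) (score (beats S) i ≟ j))

  good⇒eachScoreOnce : GoodUpTo S n → EachScoreOnce (beats S)
  good⇒eachScoreOnce good j j<n = trans (sym (count-ℓ≡count-score j)) (good j j<n)

  eachScoreOnce⇒good : EachScoreOnce (beats S) → GoodUpTo S n
  eachScoreOnce⇒good once j j<n = trans (count-ℓ≡count-score j) (once j j<n)

  good⇒≤n : ∀ {k} → GoodUpTo S k → k ≤ n
  good⇒≤n good = ℕₚ.≮⇒≥ λ n<k → contradiction (begin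
    0                                                ≡⟨ count-false no-score-n ⟨
    count (λ i → does (score (beats S) i ≟ n))       ≡⟨ count-ℓ≡count-score n ⟨
    count (λ i → ⌊ ℓ S i ℤ.≟ + n ⌋)                  ≡⟨ good n n<k ⟩
    1                                                ∎) λ ()
    where
    open ≡-Reasoning
    no-score-n : ∀ i → does (score (beats S) i ≟ n) ≡ false
    no-score-n i = dec-false (score (beats S) i ≟ n) (ℕₚ.<⇒≢ (IsTournament.score<n beats-isTournament i))

module _ {S : Rel₂ n} {w : Permutation′ n} (S≐w : S ≐R w) where

  w-injective : ∀ {i j} → w ⟨$⟩ʳ i ≡ w ⟨$⟩ʳ j → i ≡ j
  w-injective = Injection.injective (↔⇒↣ w)

  ≐R⇒upper : Upper S
  ≐R⇒upper a b Sab with _ , _ , _ , wj<wi , refl , refl ← Equivalence.to (S≐w a b) Sab = wj<wi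

  S-on-w : ∀ {i j} → w ⟨$⟩ʳ i F.< w ⟨$⟩ʳ j → S (w ⟨$⟩ʳ i) (w ⟨$⟩ʳ j) ≡ does (j Fₚ.<? i)
  S-on-w {i} {j} wi<wj = ≡-does to from (j Fₚ.<? i)
    where
    to : S (w ⟨$⟩ʳ i) (w ⟨$⟩ʳ j) ≡ true → j F.< i
    to s with i′ , j′ , i′<j′ , _ , wi≡wj′ , wj≡wi′ ← Equivalence.to (S≐w _ _) s =
      subst₂ F._<_ (sym (w-injective wj≡wi′)) (sym (w-injective wi≡wj′)) i′<j′
    from : j F.< i → S (w ⟨$⟩ʳ i) (w ⟨$⟩ʳ j) ≡ true
    from j<i = Equivalence.from (S≐w _ _) (j , i , j<i , wi<wj , refl , refl)

  ≐R⇒ranked : RankedBy (beats S) w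
  ≐R⇒ranked i j with Fₚ.<-cmp (w ⟨$⟩ʳ i) (w ⟨$⟩ʳ j)
  ... | tri< wi<wj _ _ = trans (beats-below ≐R⇒upper wi<wj) (S-on-w wi<wj)
  ... | tri≈ _ wi≡wj _ = begin
    beats S (w ⟨$⟩ʳ j) (w ⟨$⟩ʳ i)  ≡⟨ cong (beats S (w ⟨$⟩ʳ j)) wi≡wj ⟩
    beats S (w ⟨$⟩ʳ j) (w ⟨$⟩ʳ j)  ≡⟨ IsTournament.irrefl (beats-isTournament ≐R⇒upper) (w ⟨$⟩ʳ j) ⟩
    false                          ≡⟨ dec-false (j Fₚ.<? i) (Fₚ.<-irrefl (sym (w-injective wi≡wj))) ⟨
    does (j Fₚ.<? i)               ∎
    where open ≡-Reasoning
  ... | tri> _ wi≢wj wj<wi = begin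
    beats S (w ⟨$⟩ʳ j) (w ⟨$⟩ʳ i)  ≡⟨ beats-above ≐R⇒upper wj<wi ⟩
    not (S (w ⟨$⟩ʳ j) (w ⟨$⟩ʳ i))  ≡⟨ cong not (S-on-w wj<wi) ⟩
    not (does (i Fₚ.<? j))         ≡⟨ not-<? (wi≢wj ∘ cong (w ⟨$⟩ʳ_)) ⟩
    does (j Fₚ.<? i)               ∎
    where open ≡-Reasoning

ranked⇒≐R : {S : Rel₂ n} {w : Permutation′ n} → Upper S → RankedBy (beats S) w → S ≐R w
ranked⇒≐R {S = S} {w} upper ranked a b = mk⇔ to from
  where
  open ≡-Reasoning
  to : S a b ≡ true → R w a b
  to Sab = b′ , a′ , b′<a′ , subst₂ F._<_ (sym (inverseʳ w)) (sym (inverseʳ w)) (upper a b Sab)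
         , sym (inverseʳ w) , sym (inverseʳ w)
    where
    a′ = w ⟨$⟩ˡ a
    b′ = w ⟨$⟩ˡ b
    b′<a′ : b′ F.< a′
    b′<a′ = witness (b′ Fₚ.<? a′) (begin
      does (b′ Fₚ.<? a′)              ≡⟨ ranked a′ b′ ⟨
      beats S (w ⟨$⟩ʳ b′) (w ⟨$⟩ʳ a′) ≡⟨ cong₂ (beats S) (inverseʳ w) (inverseʳ w) ⟩
      beats S b a                     ≡⟨ beats-below upper (upper a b Sab) ⟩
      S a b                           ≡⟨ Sab ⟩
      true                            ∎)
  from : R w a b → S a b ≡ true
  from (i , j , i<j , wj<wi , refl , refl) = begin
    S (w ⟨$⟩ʳ j) (w ⟨$⟩ʳ i)         ≡⟨ beats-below upper wj<wi ⟨
    beats S (w ⟨$⟩ʳ i) (w ⟨$⟩ʳ j)   ≡⟨ ranked j i ⟩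
    does (i Fₚ.<? j)                ≡⟨ dec-true (i Fₚ.<? j) i<j ⟩
    true                            ∎

lemma3p3 : (n : ℕ) → 1 ≤ n →
    ((S : Rel₂ n) → Upper S → IsK S n → ∃[ w ] (S ≐R w))
    × ((w : Permutation′ n) → (S : Rel₂ n) → S ≐R w →
         IsK S n × ((j : Fin n) → ℓ S (w ⟨$⟩ʳ j) ≡ + (n ∸ suc (toℕ j))))
lemma3p3 n _ = permutation-of-K , K-of-permutation
  where
  permutation-of-K : (S : Rel₂ n) → Upper S → IsK S n → ∃[ w ] (S ≐R w)
  permutation-of-K S upper (good , _) = ranking , ranked⇒≐R {w = ranking} upper ranking-ranks
    where open Transitive (beats-isTournament upper) (good⇒eachScoreOnce upper good)

  K-of-permutation : (w : Permutation′ n) (S : Rel₂ n) → S ≐R w →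
                     IsK S n × ((j : Fin n) → ℓ S (w ⟨$⟩ʳ j) ≡ + (n ∸ suc (toℕ j)))
  K-of-permutation w S S≐w = (eachScoreOnce⇒good upper once , λ _ → good⇒≤n upper) , ℓ-at-w
    where
    upper : Upper S
    upper = ≐R⇒upper {S = S} {w} S≐w
    ranked : RankedBy (beats S) w
    ranked = ≐R⇒ranked {S = S} {w} S≐w
    once : EachScoreOnce (beats S)
    once = ranked⇒eachScoreOnce {T = beats S} {w} ranked
    ℓ-at-w : ∀ j → ℓ S (w ⟨$⟩ʳ j) ≡ + (n ∸ suc (toℕ j))
    ℓ-at-w j = trans (ℓ≡score upper (w ⟨$⟩ʳ j)) (cong +_ (ranked-score {T = beats S} {w} ranked j))
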